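{- Let $k\ge1$ be an integer and assume that a $(2k,k,k-1)$ Steiner system exists. Then $\theta(J(2k,k)) = C_k = \frac{1}{k+1}\binom{2k}{k}$.
   Context: For integers $0<k<N$, the Johnson graph $J(N,k)$ has as vertices the $k$-element subsets of $\{1,\dots,N\}$, two being adjacent iff they share exactly $k-1$ elements; $\theta(G)$ is the smallest number of cliques of $G$ whose vertex sets cover all vertices. A $(v,s,t)$ Steiner system is a pair $(X,\mathcal{B})$ with $|X|=v$ and $\mathcal{B}$ a family of $s$-element subsets of $X$ such that every $t$-element subset of $X$ is contained in exactly one member of $\mathcal{B}$. -}

module Defs where

open import Data.Nat using (ℕ; zero; suc; _+_; _*_; _∸_; _≤_; _/_)
open import Data.Nat.Combinatorics using (_C_)
open import Data.Fin using (Fin)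
open import Data.Fin.Subset using (Subset; _∩_; ∣_∣; _⊆_)
open import Data.Product using (Σ; _×_; ∃)
open import Relation.Binary.PropositionalEquality using (_≡_)
open import Relation.Nullary using (¬_)

-- Vertices of the Johnson graph J(N,k): k-element subsets of {1..N} (= Fin N).
IsVertex : (N k : ℕ) → Subset N → Set
IsVertex N k A = ∣ A ∣ ≡ k

Adjacent : (N k : ℕ) → Subset N → Subset N → Set
Adjacent N k A B = ∣ A ∩ B ∣ ≡ k ∸ 1

IsClique : (N k : ℕ) → (Subset N → Set) → Set
IsClique N k C =
  (∀ A → C A → IsVertex N k A) ×
  (∀ A B → C A → C B → ¬ (A ≡ B) → Adjacent N k A B)

CliqueCover : (N k m : ℕ) → Set₁
CliqueCover N k m =
  Σ (Fin m → Subset N → Set) λ C →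
    (∀ i → IsClique N k (C i)) ×
    (∀ A → IsVertex N k A → ∃ λ i → C i A)

CliqueCoverNumberIs : (N k m : ℕ) → Set₁
CliqueCoverNumberIs N k m =
  CliqueCover N k m × (∀ m′ → CliqueCover N k m′ → m ≤ m′)

IsSteinerSystem : (v s t : ℕ) → (Subset v → Set) → Set
IsSteinerSystem v s t 𝓑 =
  (∀ B → 𝓑 B → ∣ B ∣ ≡ s) ×
  (∀ T → ∣ T ∣ ≡ t →
     (∃ λ B → 𝓑 B × T ⊆ B) ×
     (∀ B B′ → 𝓑 B → T ⊆ B → 𝓑 B′ → T ⊆ B′ → B ≡ B′))

SteinerSystemExists : (v s t : ℕ) → Set₁
SteinerSystemExists v s t = ∃ λ (𝓑 : Subset v → Set) → IsSteinerSystem v s t 𝓑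

catalan : ℕ → ℕ
catalan k = ((2 * k) C k) / suc k

-- Let k = t + 1 and let b be the number of blocks. Two distinct blocks never share t points,
-- so no clique of J(2k, k) contains two blocks and every clique cover has at least b cliques.
-- Double counting the pairs T ⊂ B with |T| = t gives k·b = C(2k, k−1), which together with
-- (k+1)·C(2k, k−1) = k·C(2k, k) says b = C_k. Double counting the pairs B ⊂ U with
-- |U| = k + 1 shows that every (k+1)-set, which contains at most one block, contains exactly
-- one. Now fix a point 0 and give a block B the star of the k-sets containing B − 0 if 0 ∈ B,
-- and the top of the k-subsets of B + 0 otherwise: a k-set X lies in the clique of the block
-- through X − 0 if 0 ∈ X, and in that of the block inside X + 0 if 0 ∉ X.
module Submission where

open import Defs
open import Level using (Level)
open import Function using (_∘_)
open import Data.Bool using (if_then_else_)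
import Data.Bool as Bool
open import Data.Fin using (Fin; zero; suc)
open import Data.Fin.Properties using (injective⇒≤)
open import Data.Fin.Subset using (Subset; inside; outside; ∣_∣; _⊆_; _∩_; _∪_; ⊥)
open import Data.Fin.Subset.Properties
  using (_⊆?_; ⊆-refl; ⊆-reflexive; ⊆-trans; ⊥⊆; ∣⊥∣≡0; drop-∷-⊆; s⊆s; out⊆; ∣p∣≤n;
         p⊆q⇒∣p∣≤∣q∣; p∩q⊆p; p∩q⊆q; x∈p∩q⁺; ∣p∩q∣≤∣p∣; x∈p∪q⁻)
open import Data.List using (List; []; _∷_; _++_; map; length; lookup; filter)
open import Data.List.Properties using (map-++; map-∘; length-map; length-++)
import Data.List.Relation.Unary.All as All
open import Data.List.Relation.Unary.Any using (here; there; index)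
open import Data.List.Relation.Unary.Any.Properties using (lookup-index)
open import Data.List.Relation.Unary.Unique.Propositional using (Unique; []; _∷_)
open import Data.List.Relation.Unary.Unique.Propositional.Properties using (map⁺; ++⁺; filter⁺)
open import Data.List.Membership.Propositional using (_∈_)
open import Data.List.Membership.Propositional.Properties
  using (∈-filter⁺; ∈-filter⁻; ∈-lookup; ∈-map⁺; ∈-map⁻; ∈-++⁺ˡ; ∈-++⁺ʳ; ∈-++⁻)
open import Data.Nat using (ℕ; zero; suc; _+_; _*_; _∸_; _/_; _≤_; _<_; z≤n; s≤s; s≤s⁻¹; _≟_)
open import Data.Nat.Properties hiding (_≟_)
open import Algebra.Properties.CommutativeSemigroup +-commutativeSemigroup using (interchange)
open import Algebra.Properties.CommutativeSemigroup *-commutativeSemigroup using (xy∙z≈xz∙y)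
open import Data.Nat.Combinatorics using (_C_; nCk+nC[k+1]≡[n+1]C[k+1]; nCk≡nC[n∸k]; nC1≡n)
open import Data.Nat.DivMod using (m*n/n≡m)
open import Data.Nat.ListAction using (sum)
open import Data.Nat.ListAction.Properties using (sum-++)
open import Data.Product using (∃; _×_; _,_; proj₁; proj₂)
open import Data.Sum using ([_,_]; inj₁; inj₂)
import Data.Vec.Base as Vec
open import Data.Vec using ([]; _∷_)
open import Data.Vec.Properties using (∷-injectiveʳ; ≡-dec)
open import Relation.Binary.PropositionalEquality
  using (_≡_; _≢_; refl; sym; trans; cong; cong₂; subst; module ≡-Reasoning)
open import Relation.Nullary using (Dec; does; yes; no; ¬_; contradiction)
open import Relation.Unary using (Pred; Decidable)

private variable
  a ℓ : Level
  A B : Set a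
  x : A
  xs : List A
  n k : ℕ
  p q r : Subset n

∑ : List A → (A → ℕ) → ℕ
∑ xs f = sum (map f xs)

syntax ∑ xs (λ x → e) = ∑[ x ∈ xs ] e

∑-zero : ∀ (xs : List A) → ∑[ x ∈ xs ] 0 ≡ 0
∑-zero []       = refl
∑-zero (x ∷ xs) = ∑-zero xs

∑-const : ∀ xs {f : A → ℕ} c → (∀ {x} → x ∈ xs → f x ≡ c) → ∑ xs f ≡ length xs * c
∑-const []       c f≡c = refl
∑-const (x ∷ xs) c f≡c = cong₂ _+_ (f≡c (here refl)) (∑-const xs c (f≡c ∘ there))

∑-+ : ∀ (f g : A → ℕ) xs → ∑[ x ∈ xs ] (f x + g x) ≡ ∑ xs f + ∑ xs g
∑-+ f g []       = refl
∑-+ f g (x ∷ xs) = trans (cong (f x + g x +_) (∑-+ f g xs)) (interchange (f x) (g x) _ _)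

∑-comm : ∀ (f : A → B → ℕ) xs ys →
         ∑[ x ∈ xs ] ∑[ y ∈ ys ] f x y ≡ ∑[ y ∈ ys ] ∑[ x ∈ xs ] f x y
∑-comm f []       ys = sym (∑-zero ys)
∑-comm f (x ∷ xs) ys = trans (cong (∑ ys (f x) +_) (∑-comm f xs ys))
                             (sym (∑-+ (f x) (λ y → ∑[ x ∈ xs ] f x y) ys))

∑-++ : ∀ (f : A → ℕ) xs ys → ∑ (xs ++ ys) f ≡ ∑ xs f + ∑ ys f
∑-++ f xs ys = trans (cong sum (map-++ f xs ys)) (sum-++ (map f xs) (map f ys))

∑-map : ∀ (f : B → ℕ) (g : A → B) xs → ∑ (map g xs) f ≡ ∑ xs (f ∘ g)
∑-map f g xs = cong sum (sym (map-∘ xs))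

∑≤length : {f : A → ℕ} → (∀ {x} → x ∈ xs → f x ≤ 1) → ∑ xs f ≤ length xs
∑≤length {xs = []}     f≤1 = z≤n
∑≤length {xs = x ∷ xs} f≤1 = +-mono-≤ (f≤1 (here refl)) (∑≤length (f≤1 ∘ there))

∑≡length⇒≡1 : {f : A → ℕ} → (∀ {x} → x ∈ xs → f x ≤ 1) → ∑ xs f ≡ length xs →
              x ∈ xs → f x ≡ 1
∑≡length⇒≡1 {xs = y ∷ ys} {f = f} f≤1 ∑≡length = go
  where
  tight : ∀ {a b l} → a ≤ 1 → b ≤ l → a + b ≡ suc l → a ≡ 1 × b ≡ l
  tight {0}           _        b≤l b≡1+l = contradiction (≤-reflexive (sym b≡1+l)) (<⇒≱ (s≤s b≤l))
  tight {1}           _        _   1+b≡1+l = refl , suc-injective 1+b≡1+l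
  tight {suc (suc _)} (s≤s ()) _   _

  head≡1 : f y ≡ 1 × ∑ ys f ≡ length ys
  head≡1 = tight (f≤1 (here refl)) (∑≤length (f≤1 ∘ there)) ∑≡length

  go : ∀ {x} → x ∈ y ∷ ys → f x ≡ 1
  go (here refl) = proj₁ head≡1
  go (there x∈)  = ∑≡length⇒≡1 (f≤1 ∘ there) (proj₂ head≡1) x∈

𝟙 : {P : Set ℓ} → Dec P → ℕ
𝟙 P? = if does P? then 1 else 0

count : {P : Pred A ℓ} → Decidable P → List A → ℕ
count P? xs = ∑[ x ∈ xs ] 𝟙 (P? x)

module _ {P : Pred A ℓ} (P? : Decidable P) where

  count≡0 : (∀ {x} → x ∈ xs → ¬ P x) → count P? xs ≡ 0
  count≡0 {xs = []}     ¬P = refl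
  count≡0 {xs = x ∷ xs} ¬P with P? x
  ... | yes px = contradiction px (¬P (here refl))
  ... | no  _  = count≡0 (¬P ∘ there)

  count≤1 : Unique xs → (∀ {x y} → x ∈ xs → y ∈ xs → P x → P y → x ≡ y) → count P? xs ≤ 1
  count≤1 []                    _      = z≤n
  count≤1 {xs = x ∷ xs} (x∉xs ∷ u) unique with P? x
  ... | yes px = ≤-reflexive (cong suc (count≡0 λ y∈ py →
                   All.lookup x∉xs y∈ (unique (here refl) (there y∈) px py)))
  ... | no  _  = count≤1 u (λ x∈ y∈ → unique (there x∈) (there y∈))

  count≥1 : x ∈ xs → P x → 1 ≤ count P? xs
  count≥1 {xs = y ∷ ys} (here refl) px with P? y
  ... | yes _   = s≤s z≤n
  ... | no  ¬px = contradiction px ¬px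
  count≥1 {xs = y ∷ ys} (there x∈) px = ≤-trans (count≥1 x∈ px) (m≤n+m _ (𝟙 (P? y)))

  count>0⇒∃ : 0 < count P? xs → ∃ λ x → x ∈ xs × P x
  count>0⇒∃ {xs = x ∷ xs} count>0 with P? x
  ... | yes px = x , here refl , px
  ... | no  _  = let y , y∈ , py = count>0⇒∃ count>0 in y , there y∈ , py

Unique-lookup-injective : Unique xs → ∀ {i j} → lookup xs i ≡ lookup xs j → i ≡ j
Unique-lookup-injective (_ ∷ _)    {zero}  {zero}  _  = refl
Unique-lookup-injective (x∉xs ∷ _) {zero}  {suc j} eq =
  contradiction eq (All.lookup x∉xs (∈-lookup j))
Unique-lookup-injective (x∉xs ∷ _) {suc i} {zero}  eq =
  contradiction (sym eq) (All.lookup x∉xs (∈-lookup i))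
Unique-lookup-injective (_ ∷ u)    {suc i} {suc j} eq = cong suc (Unique-lookup-injective u eq)

∣p∩q∣+∣p∪q∣≡∣p∣+∣q∣ : ∀ (p q : Subset n) → ∣ p ∩ q ∣ + ∣ p ∪ q ∣ ≡ ∣ p ∣ + ∣ q ∣
∣p∩q∣+∣p∪q∣≡∣p∣+∣q∣ []            []            = refl
∣p∩q∣+∣p∪q∣≡∣p∣+∣q∣ (inside ∷ p)  (inside ∷ q)  =
  cong suc (trans (+-suc _ _) (trans (cong suc (∣p∩q∣+∣p∪q∣≡∣p∣+∣q∣ p q)) (sym (+-suc _ _))))
∣p∩q∣+∣p∪q∣≡∣p∣+∣q∣ (inside ∷ p)  (outside ∷ q) =
  trans (+-suc _ _) (cong suc (∣p∩q∣+∣p∪q∣≡∣p∣+∣q∣ p q))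
∣p∩q∣+∣p∪q∣≡∣p∣+∣q∣ (outside ∷ p) (inside ∷ q)  =
  trans (+-suc _ _) (trans (cong suc (∣p∩q∣+∣p∪q∣≡∣p∣+∣q∣ p q)) (sym (+-suc _ _)))
∣p∩q∣+∣p∪q∣≡∣p∣+∣q∣ (outside ∷ p) (outside ∷ q) = ∣p∩q∣+∣p∪q∣≡∣p∣+∣q∣ p q

p⊆q⇒∣q∣≤∣p∣⇒p≡q : p ⊆ q → ∣ q ∣ ≤ ∣ p ∣ → p ≡ q
p⊆q⇒∣q∣≤∣p∣⇒p≡q {p = []}          {[]}          _   _   = refl
p⊆q⇒∣q∣≤∣p∣⇒p≡q {p = inside ∷ p}  {inside ∷ q}  p⊆q q≤p =
  cong (inside ∷_) (p⊆q⇒∣q∣≤∣p∣⇒p≡q (drop-∷-⊆ p⊆q) (s≤s⁻¹ q≤p))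
p⊆q⇒∣q∣≤∣p∣⇒p≡q {p = inside ∷ p}  {outside ∷ q} p⊆q _   = contradiction (p⊆q Vec.here) λ ()
p⊆q⇒∣q∣≤∣p∣⇒p≡q {p = outside ∷ p} {inside ∷ q}  p⊆q q≤p =
  contradiction q≤p (<⇒≱ (s≤s (p⊆q⇒∣p∣≤∣q∣ (drop-∷-⊆ p⊆q))))
p⊆q⇒∣q∣≤∣p∣⇒p≡q {p = outside ∷ p} {outside ∷ q} p⊆q q≤p =
  cong (outside ∷_) (p⊆q⇒∣q∣≤∣p∣⇒p≡q (drop-∷-⊆ p⊆q) q≤p)

p≢q⇒∣p∩q∣<k : ∣ p ∣ ≡ k → ∣ q ∣ ≡ k → p ≢ q → ∣ p ∩ q ∣ < k
p≢q⇒∣p∩q∣<k {p = p} {q = q} refl ∣q∣≡∣p∣ p≢q = ≤∧≢⇒< (∣p∩q∣≤∣p∣ p q) (p≢q ∘ p≡q)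
  where
  p≡q : ∣ p ∩ q ∣ ≡ ∣ p ∣ → p ≡ q
  p≡q ∣p∩q∣≡∣p∣ = trans (sym (p∩q≡ (p∩q⊆p p q) refl)) (p∩q≡ (p∩q⊆q p q) ∣q∣≡∣p∣)
    where
    p∩q≡ : ∀ {r} → p ∩ q ⊆ r → ∣ r ∣ ≡ ∣ p ∣ → p ∩ q ≡ r
    p∩q≡ p∩q⊆r ∣r∣≡∣p∣ = p⊆q⇒∣q∣≤∣p∣⇒p≡q p∩q⊆r (≤-reflexive (trans ∣r∣≡∣p∣ (sym ∣p∩q∣≡∣p∣)))

∪-least : p ⊆ r → q ⊆ r → p ∪ q ⊆ r
∪-least {p = p} {q = q} p⊆r q⊆r = [ p⊆r , q⊆r ] ∘ x∈p∪q⁻ p q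

∣p∣+∣q∣≤∣p∩q∣+∣r∣ : p ⊆ r → q ⊆ r → ∣ p ∣ + ∣ q ∣ ≤ ∣ p ∩ q ∣ + ∣ r ∣
∣p∣+∣q∣≤∣p∩q∣+∣r∣ {p = p} {r = r} {q = q} p⊆r q⊆r = begin
  ∣ p ∣ + ∣ q ∣         ≡⟨ ∣p∩q∣+∣p∪q∣≡∣p∣+∣q∣ p q ⟨
  ∣ p ∩ q ∣ + ∣ p ∪ q ∣ ≤⟨ +-monoʳ-≤ ∣ p ∩ q ∣ (p⊆q⇒∣p∣≤∣q∣ (∪-least p⊆r q⊆r)) ⟩
  ∣ p ∩ q ∣ + ∣ r ∣     ∎
  where open ≤-Reasoning

⊆[2+t]⇒t≤∣p∩q∣ : ∀ {n t} {p q r : Subset n} →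
                 ∣ p ∣ ≡ suc t → ∣ q ∣ ≡ suc t → ∣ r ∣ ≡ suc (suc t) → p ⊆ r → q ⊆ r →
                 t ≤ ∣ p ∩ q ∣
⊆[2+t]⇒t≤∣p∩q∣ {t = t} {p} {q} {r} ∣p∣≡ ∣q∣≡ ∣r∣≡ p⊆r q⊆r =
  +-cancelʳ-≤ (suc (suc t)) t ∣ p ∩ q ∣ (begin
    t + suc (suc t)         ≡⟨ +-suc t (suc t) ⟩
    suc t + suc t           ≡⟨ cong₂ _+_ ∣p∣≡ ∣q∣≡ ⟨
    ∣ p ∣ + ∣ q ∣           ≤⟨ ∣p∣+∣q∣≤∣p∩q∣+∣r∣ p⊆r q⊆r ⟩
    ∣ p ∩ q ∣ + ∣ r ∣       ≡⟨ cong (∣ p ∩ q ∣ +_) ∣r∣≡ ⟩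
    ∣ p ∩ q ∣ + suc (suc t) ∎)
  where open ≤-Reasoning

∃-⊆-ofSize : ∀ {n j} {p : Subset n} → j ≤ ∣ p ∣ → ∃ λ q → q ⊆ p × ∣ q ∣ ≡ j
∃-⊆-ofSize {n} {zero} _ = ⊥ , ⊥⊆ , ∣⊥∣≡0 n
∃-⊆-ofSize {j = suc j} {p = inside ∷ p} j≤∣p∣ =
  let q , q⊆p , ∣q∣≡j = ∃-⊆-ofSize (s≤s⁻¹ j≤∣p∣) in inside ∷ q , s⊆s q⊆p , cong suc ∣q∣≡j
∃-⊆-ofSize {j = suc j} {p = outside ∷ p} j≤∣p∣ =
  let q , q⊆p , ∣q∣≡j = ∃-⊆-ofSize j≤∣p∣ in outside ∷ q , s⊆s q⊆p , ∣q∣≡j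

subsetsOfSize : (n j : ℕ) → List (Subset n)
subsetsOfSize zero    zero    = [] ∷ []
subsetsOfSize zero    (suc j) = []
subsetsOfSize (suc n) zero    = map (outside ∷_) (subsetsOfSize n zero)
subsetsOfSize (suc n) (suc j) =
  map (inside ∷_) (subsetsOfSize n j) ++ map (outside ∷_) (subsetsOfSize n (suc j))

∈-subsetsOfSize⁺ : ∀ {n j} {p : Subset n} → ∣ p ∣ ≡ j → p ∈ subsetsOfSize n j
∈-subsetsOfSize⁺ {zero}  {zero}  {[]}          _     = here refl
∈-subsetsOfSize⁺ {suc n} {zero}  {outside ∷ p} ∣p∣≡0 =
  ∈-map⁺ (outside ∷_) (∈-subsetsOfSize⁺ {p = p} ∣p∣≡0)
∈-subsetsOfSize⁺ {suc n} {suc j} {inside ∷ p}  ∣p∣≡j =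
  ∈-++⁺ˡ (∈-map⁺ (inside ∷_) (∈-subsetsOfSize⁺ {p = p} (suc-injective ∣p∣≡j)))
∈-subsetsOfSize⁺ {suc n} {suc j} {outside ∷ p} ∣p∣≡j =
  ∈-++⁺ʳ (map (inside ∷_) (subsetsOfSize n j))
         (∈-map⁺ (outside ∷_) (∈-subsetsOfSize⁺ {p = p} ∣p∣≡j))

∈-subsetsOfSize⁻ : ∀ {n j} {p : Subset n} → p ∈ subsetsOfSize n j → ∣ p ∣ ≡ j
∈-subsetsOfSize⁻ {zero}  {zero}  (here refl) = refl
∈-subsetsOfSize⁻ {suc n} {zero}  p∈ with _ , q∈ , refl ← ∈-map⁻ _ p∈ = ∈-subsetsOfSize⁻ q∈
∈-subsetsOfSize⁻ {suc n} {suc j} p∈ with ∈-++⁻ (map (inside ∷_) (subsetsOfSize n j)) p∈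
... | inj₁ p∈ˡ with _ , q∈ , refl ← ∈-map⁻ _ p∈ˡ = cong suc (∈-subsetsOfSize⁻ q∈)
... | inj₂ p∈ʳ with _ , q∈ , refl ← ∈-map⁻ _ p∈ʳ = ∈-subsetsOfSize⁻ q∈

Unique-subsetsOfSize : ∀ n j → Unique (subsetsOfSize n j)
Unique-subsetsOfSize zero    zero    = All.[] ∷ []
Unique-subsetsOfSize zero    (suc j) = []
Unique-subsetsOfSize (suc n) zero    = map⁺ ∷-injectiveʳ (Unique-subsetsOfSize n zero)
Unique-subsetsOfSize (suc n) (suc j) =
  ++⁺ (map⁺ ∷-injectiveʳ (Unique-subsetsOfSize n j))
      (map⁺ ∷-injectiveʳ (Unique-subsetsOfSize n (suc j)))
      heads-differ
  where
  heads-differ : ∀ {p} → ¬ (p ∈ map (inside ∷_) (subsetsOfSize n j) ×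
                            p ∈ map (outside ∷_) (subsetsOfSize n (suc j)))
  heads-differ (p∈ˡ , p∈ʳ) with _ , _ , refl ← ∈-map⁻ _ p∈ˡ | _ , _ , () ← ∈-map⁻ _ p∈ʳ

length-subsetsOfSize : ∀ n j → length (subsetsOfSize n j) ≡ n C j
length-subsetsOfSize zero    zero    = refl
length-subsetsOfSize zero    (suc j) = refl
length-subsetsOfSize (suc n) zero    =
  trans (length-map _ (subsetsOfSize n zero)) (length-subsetsOfSize n zero)
length-subsetsOfSize (suc n) (suc j) = begin
  length (map (inside ∷_) (subsetsOfSize n j) ++ map (outside ∷_) (subsetsOfSize n (suc j)))
    ≡⟨ length-++ (map (inside ∷_) (subsetsOfSize n j)) ⟩
  length (map (inside ∷_) (subsetsOfSize n j)) + length (map (outside ∷_) (subsetsOfSize n (suc j)))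
    ≡⟨ cong₂ _+_ (length-map _ (subsetsOfSize n j)) (length-map _ (subsetsOfSize n (suc j))) ⟩
  length (subsetsOfSize n j) + length (subsetsOfSize n (suc j))
    ≡⟨ cong₂ _+_ (length-subsetsOfSize n j) (length-subsetsOfSize n (suc j)) ⟩
  n C j + n C suc j
    ≡⟨ nCk+nC[k+1]≡[n+1]C[k+1] n j ⟩
  suc n C suc j ∎
  where open ≡-Reasoning

∑-subsetsOfSize-suc : ∀ n j (f : Subset (suc n) → ℕ) →
  ∑ (subsetsOfSize (suc n) (suc j)) f ≡
  ∑[ p ∈ subsetsOfSize n j ] f (inside ∷ p) + ∑[ p ∈ subsetsOfSize n (suc j) ] f (outside ∷ p)
∑-subsetsOfSize-suc n j f = trans (∑-++ f (map (inside ∷_) (subsetsOfSize n j)) _)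
  (cong₂ _+_ (∑-map f (inside ∷_) (subsetsOfSize n j))
             (∑-map f (outside ∷_) (subsetsOfSize n (suc j))))

count-⊆ : ∀ n j (p : Subset n) → count (_⊆? p) (subsetsOfSize n j) ≡ ∣ p ∣ C j
count-⊆ zero    zero    []      = refl
count-⊆ zero    (suc j) []      = refl
count-⊆ (suc n) zero    (_ ∷ p) =
  trans (∑-map _ (outside ∷_) (subsetsOfSize n zero)) (count-⊆ n zero p)
count-⊆ (suc n) (suc j) (inside ∷ p) = begin
  count (_⊆? inside ∷ p) (subsetsOfSize (suc n) (suc j))
    ≡⟨ ∑-subsetsOfSize-suc n j _ ⟩
  count (_⊆? p) (subsetsOfSize n j) + count (_⊆? p) (subsetsOfSize n (suc j))
    ≡⟨ cong₂ _+_ (count-⊆ n j p) (count-⊆ n (suc j) p) ⟩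
  ∣ p ∣ C j + ∣ p ∣ C suc j
    ≡⟨ nCk+nC[k+1]≡[n+1]C[k+1] ∣ p ∣ j ⟩
  suc ∣ p ∣ C suc j ∎
  where open ≡-Reasoning
count-⊆ (suc n) (suc j) (outside ∷ p) = begin
  count (_⊆? outside ∷ p) (subsetsOfSize (suc n) (suc j))
    ≡⟨ ∑-subsetsOfSize-suc n j _ ⟩
  ∑[ q ∈ subsetsOfSize n j ] 0 + count (_⊆? p) (subsetsOfSize n (suc j))
    ≡⟨ cong₂ _+_ (∑-zero (subsetsOfSize n j)) (count-⊆ n (suc j) p) ⟩
  ∣ p ∣ C suc j ∎
  where open ≡-Reasoning

[1+j]Cj≡1+j : ∀ j → suc j C j ≡ suc j
[1+j]Cj≡1+j j = begin
  suc j C j           ≡⟨ nCk≡nC[n∸k] (n≤1+n j) ⟩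
  suc j C (suc j ∸ j) ≡⟨ cong (suc j C_) (m+n∸n≡m 1 j) ⟩
  suc j C 1           ≡⟨ nC1≡n (suc j) ⟩
  suc j               ∎
  where open ≡-Reasoning

count-⊆-oneSmaller : ∀ {n j} (p : Subset n) → ∣ p ∣ ≡ suc j →
                     count (_⊆? p) (subsetsOfSize n j) ≡ suc j
count-⊆-oneSmaller {n} {j} p ∣p∣≡1+j =
  trans (count-⊆ n j p) (trans (cong (_C j) ∣p∣≡1+j) ([1+j]Cj≡1+j j))

count-⊇-sameSize : ∀ {n} (p : Subset n) → count (p ⊆?_) (subsetsOfSize n ∣ p ∣) ≡ 1
count-⊇-sameSize {n} p = ≤-antisym
  (count≤1 (p ⊆?_) (Unique-subsetsOfSize n ∣ p ∣) λ q∈ r∈ p⊆q p⊆r →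
    trans (sym (p≡ p⊆q q∈)) (p≡ p⊆r r∈))
  (count≥1 (p ⊆?_) (∈-subsetsOfSize⁺ refl) ⊆-refl)
  where
  p≡ : ∀ {q} → p ⊆ q → q ∈ subsetsOfSize n ∣ p ∣ → p ≡ q
  p≡ p⊆q q∈ = p⊆q⇒∣q∣≤∣p∣⇒p≡q p⊆q (≤-reflexive (∈-subsetsOfSize⁻ q∈))

count-⊇-oneLarger : ∀ {n j} (p : Subset n) → ∣ p ∣ ≡ j →
                    count (p ⊆?_) (subsetsOfSize n (suc j)) ≡ n ∸ j
count-⊇-oneLarger {zero}  []            refl = refl
count-⊇-oneLarger {suc n} (inside ∷ p)  refl = begin
  count (inside ∷ p ⊆?_) (subsetsOfSize (suc n) (suc (suc ∣ p ∣)))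
    ≡⟨ ∑-subsetsOfSize-suc n (suc ∣ p ∣) _ ⟩
  count (p ⊆?_) (subsetsOfSize n (suc ∣ p ∣)) + ∑[ q ∈ subsetsOfSize n (suc (suc ∣ p ∣)) ] 0
    ≡⟨ cong₂ _+_ (count-⊇-oneLarger p refl) (∑-zero (subsetsOfSize n (suc (suc ∣ p ∣)))) ⟩
  n ∸ ∣ p ∣ + 0
    ≡⟨ +-identityʳ _ ⟩
  n ∸ ∣ p ∣ ∎
  where open ≡-Reasoning
count-⊇-oneLarger {suc n} (outside ∷ p) refl = begin
  count (outside ∷ p ⊆?_) (subsetsOfSize (suc n) (suc ∣ p ∣))
    ≡⟨ ∑-subsetsOfSize-suc n ∣ p ∣ _ ⟩
  count (p ⊆?_) (subsetsOfSize n ∣ p ∣) + count (p ⊆?_) (subsetsOfSize n (suc ∣ p ∣))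
    ≡⟨ cong₂ _+_ (count-⊇-sameSize p) (count-⊇-oneLarger p refl) ⟩
  1 + (n ∸ ∣ p ∣)
    ≡⟨ +-∸-assoc 1 (∣p∣≤n p) ⟨
  suc n ∸ ∣ p ∣ ∎
  where open ≡-Reasoning

nCj*[n∸j]≡nC[1+j]*[1+j] : ∀ n j → (n C j) * (n ∸ j) ≡ (n C suc j) * suc j
nCj*[n∸j]≡nC[1+j]*[1+j] n j = begin
  (n C j) * (n ∸ j)
    ≡⟨ cong (_* (n ∸ j)) (length-subsetsOfSize n j) ⟨
  length (subsetsOfSize n j) * (n ∸ j)
    ≡⟨ ∑-const (subsetsOfSize n j) (n ∸ j)
               (λ {T} T∈ → count-⊇-oneLarger T (∈-subsetsOfSize⁻ T∈)) ⟨
  ∑[ T ∈ subsetsOfSize n j ] count (T ⊆?_) (subsetsOfSize n (suc j))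
    ≡⟨ ∑-comm (λ T X → 𝟙 (T ⊆? X)) (subsetsOfSize n j) (subsetsOfSize n (suc j)) ⟩
  ∑[ X ∈ subsetsOfSize n (suc j) ] count (_⊆? X) (subsetsOfSize n j)
    ≡⟨ ∑-const (subsetsOfSize n (suc j)) (suc j)
               (λ {X} X∈ → count-⊆-oneSmaller X (∈-subsetsOfSize⁻ X∈)) ⟩
  length (subsetsOfSize n (suc j)) * suc j
    ≡⟨ cong (_* suc j) (length-subsetsOfSize n (suc j)) ⟩
  (n C suc j) * suc j ∎
  where open ≡-Reasoning

Star : ℕ → Subset n → Subset n → Set
Star k T X = ∣ X ∣ ≡ k × T ⊆ X

Top : ℕ → Subset n → Subset n → Set
Top k U X = ∣ X ∣ ≡ k × X ⊆ U

Star-isClique : ∀ {n t} {T : Subset n} → ∣ T ∣ ≡ t → IsClique n (suc t) (Star (suc t) T)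
Star-isClique refl = (λ _ → proj₁) , λ X Y (∣X∣≡ , T⊆X) (∣Y∣≡ , T⊆Y) X≢Y →
  ≤-antisym (s≤s⁻¹ (p≢q⇒∣p∩q∣<k ∣X∣≡ ∣Y∣≡ X≢Y))
            (p⊆q⇒∣p∣≤∣q∣ (λ x∈T → x∈p∩q⁺ (T⊆X x∈T , T⊆Y x∈T)))

Top-isClique : ∀ {n t} {U : Subset n} → ∣ U ∣ ≡ suc (suc t) → IsClique n (suc t) (Top (suc t) U)
Top-isClique ∣U∣≡ = (λ _ → proj₁) , λ X Y (∣X∣≡ , X⊆U) (∣Y∣≡ , Y⊆U) X≢Y →
  ≤-antisym (s≤s⁻¹ (p≢q⇒∣p∩q∣<k ∣X∣≡ ∣Y∣≡ X≢Y)) (⊆[2+t]⇒t≤∣p∩q∣ ∣X∣≡ ∣Y∣≡ ∣U∣≡ X⊆U Y⊆U)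

-- B is a block iff it is the block through one of its t-subsets.
IsSteinerSystem⇒Decidable : ∀ {v s t} {𝓑 : Subset v → Set} →
                            IsSteinerSystem v s t 𝓑 → t ≤ s → Decidable 𝓑
IsSteinerSystem⇒Decidable {s = s} {t} (block-size , t-subsets) t≤s B with ∣ B ∣ ≟ s
... | no ∣B∣≢s = no (∣B∣≢s ∘ block-size B)
... | yes ∣B∣≡s
  with T , T⊆B , ∣T∣≡t ← ∃-⊆-ofSize {p = B} (subst (t ≤_) (sym ∣B∣≡s) t≤s)
  with (B′ , 𝓑B′ , T⊆B′) , unique ← t-subsets T ∣T∣≡t
  with ≡-dec Bool._≟_ B B′
... | yes refl = yes 𝓑B′
... | no  B≢B′ = no λ 𝓑B → B≢B′ (unique B B′ 𝓑B T⊆B 𝓑B′ T⊆B′)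

module SteinerSystem {N t : ℕ} {𝓑 : Subset N → Set} (S : IsSteinerSystem N (suc t) t 𝓑) where

  block-size : ∀ {B} → 𝓑 B → ∣ B ∣ ≡ suc t
  block-size = proj₁ S _

  block-through : ∀ {T} → ∣ T ∣ ≡ t → ∃ λ B → 𝓑 B × T ⊆ B
  block-through ∣T∣≡t = proj₁ (proj₂ S _ ∣T∣≡t)

  block-through-unique : ∀ {T B B′} → ∣ T ∣ ≡ t → 𝓑 B → T ⊆ B → 𝓑 B′ → T ⊆ B′ → B ≡ B′
  block-through-unique ∣T∣≡t = proj₂ (proj₂ S _ ∣T∣≡t) _ _

  t≤∣B∩B′∣⇒B≡B′ : ∀ {B B′} → 𝓑 B → 𝓑 B′ → t ≤ ∣ B ∩ B′ ∣ → B ≡ B′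
  t≤∣B∩B′∣⇒B≡B′ {B} {B′} 𝓑B 𝓑B′ t≤∣B∩B′∣ =
    let T , T⊆B∩B′ , ∣T∣≡t = ∃-⊆-ofSize t≤∣B∩B′∣ in
    block-through-unique ∣T∣≡t 𝓑B (⊆-trans T⊆B∩B′ (p∩q⊆p B B′)) 𝓑B′ (⊆-trans T⊆B∩B′ (p∩q⊆q B B′))

  block? : Decidable 𝓑
  block? = IsSteinerSystem⇒Decidable S (n≤1+n t)

  blocks : List (Subset N)
  blocks = filter block? (subsetsOfSize N (suc t))

  ∈-blocks⁺ : ∀ {B} → 𝓑 B → B ∈ blocks
  ∈-blocks⁺ 𝓑B = ∈-filter⁺ block? (∈-subsetsOfSize⁺ (block-size 𝓑B)) 𝓑B

  ∈-blocks⁻ : ∀ {B} → B ∈ blocks → 𝓑 B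
  ∈-blocks⁻ B∈ = proj₂ (∈-filter⁻ block? {xs = subsetsOfSize N (suc t)} B∈)

  Unique-blocks : Unique blocks
  Unique-blocks = filter⁺ block? (Unique-subsetsOfSize N (suc t))

  count-blocks-⊇ : ∀ {T} → ∣ T ∣ ≡ t → count (T ⊆?_) blocks ≡ 1
  count-blocks-⊇ {T} ∣T∣≡t = let B , 𝓑B , T⊆B = block-through ∣T∣≡t in ≤-antisym
    (count≤1 (T ⊆?_) Unique-blocks λ B∈ B′∈ T⊆B T⊆B′ →
      block-through-unique ∣T∣≡t (∈-blocks⁻ B∈) T⊆B (∈-blocks⁻ B′∈) T⊆B′)
    (count≥1 (T ⊆?_) (∈-blocks⁺ 𝓑B) T⊆B)

  count-blocks-⊆≤1 : ∀ {U} → ∣ U ∣ ≡ suc (suc t) → count (_⊆? U) blocks ≤ 1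
  count-blocks-⊆≤1 {U} ∣U∣≡ = count≤1 (_⊆? U) Unique-blocks λ B∈ B′∈ B⊆U B′⊆U →
    let 𝓑B = ∈-blocks⁻ B∈; 𝓑B′ = ∈-blocks⁻ B′∈ in
    t≤∣B∩B′∣⇒B≡B′ 𝓑B 𝓑B′ (⊆[2+t]⇒t≤∣p∩q∣ (block-size 𝓑B) (block-size 𝓑B′) ∣U∣≡ B⊆U B′⊆U)

  length-blocks*[1+t]≡NCt : length blocks * suc t ≡ N C t
  length-blocks*[1+t]≡NCt = begin
    length blocks * suc t
      ≡⟨ ∑-const blocks (suc t) (λ {B} B∈ → count-⊆-oneSmaller B (block-size (∈-blocks⁻ B∈))) ⟨
    ∑[ B ∈ blocks ] count (_⊆? B) (subsetsOfSize N t)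
      ≡⟨ ∑-comm (λ T B → 𝟙 (T ⊆? B)) (subsetsOfSize N t) blocks ⟨
    ∑[ T ∈ subsetsOfSize N t ] count (T ⊆?_) blocks
      ≡⟨ ∑-const (subsetsOfSize N t) 1 (λ {T} T∈ → count-blocks-⊇ {T} (∈-subsetsOfSize⁻ T∈)) ⟩
    length (subsetsOfSize N t) * 1
      ≡⟨ *-identityʳ _ ⟩
    length (subsetsOfSize N t)
      ≡⟨ length-subsetsOfSize N t ⟩
    N C t ∎
    where open ≡-Reasoning

  ∑-count-blocks-⊆ : ∑[ U ∈ subsetsOfSize N (suc (suc t)) ] count (_⊆? U) blocks ≡
                     length blocks * (N ∸ suc t)
  ∑-count-blocks-⊆ =
    trans (∑-comm (λ U B → 𝟙 (B ⊆? U)) (subsetsOfSize N (suc (suc t))) blocks)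
          (∑-const blocks (N ∸ suc t) (λ {B} B∈ → count-⊇-oneLarger B (block-size (∈-blocks⁻ B∈))))

  length-blocks≤ : ∀ {m} → CliqueCover N (suc t) m → length blocks ≤ m
  length-blocks≤ {m} (C , isClique , covered) = injective⇒≤ cliqueIndex-injective
    where
    𝓑-lookup : ∀ i → 𝓑 (lookup blocks i)
    𝓑-lookup i = ∈-blocks⁻ (∈-lookup i)

    cliqueIndex : Fin (length blocks) → Fin m
    cliqueIndex i = proj₁ (covered (lookup blocks i) (block-size (𝓑-lookup i)))

    ∈-clique : ∀ i → C (cliqueIndex i) (lookup blocks i)
    ∈-clique i = proj₂ (covered (lookup blocks i) (block-size (𝓑-lookup i)))

    cliqueIndex-injective : ∀ {i j} → cliqueIndex i ≡ cliqueIndex j → i ≡ j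
    cliqueIndex-injective {i} {j} same = Unique-lookup-injective Unique-blocks same-block
      where
      same-block : lookup blocks i ≡ lookup blocks j
      same-block with ≡-dec Bool._≟_ (lookup blocks i) (lookup blocks j)
      ... | yes eq = eq
      ... | no  ne = t≤∣B∩B′∣⇒B≡B′ (𝓑-lookup i) (𝓑-lookup j) (≤-reflexive (sym adjacent))
        where
        adjacent : Adjacent N (suc t) (lookup blocks i) (lookup blocks j)
        adjacent = proj₂ (isClique (cliqueIndex i)) _ _
                     (∈-clique i) (subst (λ c → C c _) (sym same) (∈-clique j)) ne

module SteinerSystem2k {t : ℕ} {𝓑 : Subset (2 * suc t) → Set}
                       (S : IsSteinerSystem (2 * suc t) (suc t) t 𝓑) where

  open SteinerSystem S public

  2[1+t]∸t≡2+t : 2 * suc t ∸ t ≡ suc (suc t)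
  2[1+t]∸t≡2+t = trans (cong (_∸ t) 2[1+t]≡t+[2+t]) (m+n∸m≡n t (suc (suc t)))
    where
    2[1+t]≡t+[2+t] : 2 * suc t ≡ t + suc (suc t)
    2[1+t]≡t+[2+t] = trans (cong (λ m → suc (t + m)) (+-identityʳ (suc t))) (sym (+-suc t (suc t)))

  2[1+t]∸[1+t]≡1+t : 2 * suc t ∸ suc t ≡ suc t
  2[1+t]∸[1+t]≡1+t = trans (m+n∸m≡n (suc t) (suc t + 0)) (+-identityʳ (suc t))

  block-within : ∀ {U} → ∣ U ∣ ≡ suc (suc t) → ∃ λ B → 𝓑 B × B ⊆ U
  block-within {U} ∣U∣≡ =
    let B , B∈ , B⊆U = count>0⇒∃ (_⊆? U) (≤-reflexive (sym count≡1)) in B , ∈-blocks⁻ B∈ , B⊆U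
    where
    open ≡-Reasoning
    total : ∑[ V ∈ subsetsOfSize (2 * suc t) (suc (suc t)) ] count (_⊆? V) blocks ≡
            length (subsetsOfSize (2 * suc t) (suc (suc t)))
    total = begin
      ∑[ V ∈ subsetsOfSize (2 * suc t) (suc (suc t)) ] count (_⊆? V) blocks
        ≡⟨ ∑-count-blocks-⊆ ⟩
      length blocks * (2 * suc t ∸ suc t)
        ≡⟨ cong (length blocks *_) 2[1+t]∸[1+t]≡1+t ⟩
      length blocks * suc t
        ≡⟨ length-blocks*[1+t]≡NCt ⟩
      2 * suc t C t
        ≡⟨ nCk≡nC[n∸k] (≤-trans (n≤1+n t) (m≤m+n (suc t) _)) ⟩
      2 * suc t C (2 * suc t ∸ t)
        ≡⟨ cong (2 * suc t C_) 2[1+t]∸t≡2+t ⟩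
      2 * suc t C suc (suc t)
        ≡⟨ length-subsetsOfSize (2 * suc t) (suc (suc t)) ⟨
      length (subsetsOfSize (2 * suc t) (suc (suc t))) ∎

    count≡1 : count (_⊆? U) blocks ≡ 1
    count≡1 = ∑≡length⇒≡1 (λ {V} V∈ → count-blocks-⊆≤1 {V} (∈-subsetsOfSize⁻ V∈)) total
                          (∈-subsetsOfSize⁺ {p = U} ∣U∣≡)

  length-blocks≡catalan : length blocks ≡ catalan (suc t)
  length-blocks≡catalan =
    sym (trans (cong (_/ suc (suc t)) 2[1+t]C[1+t]≡) (m*n/n≡m (length blocks) (suc (suc t))))
    where
    open ≡-Reasoning
    2[1+t]C[1+t]≡ : 2 * suc t C suc t ≡ length blocks * suc (suc t)
    2[1+t]C[1+t]≡ = *-cancelʳ-≡ _ _ (suc t) (begin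
      (2 * suc t C suc t) * suc t         ≡⟨ nCj*[n∸j]≡nC[1+j]*[1+j] (2 * suc t) t ⟨
      (2 * suc t C t) * (2 * suc t ∸ t)   ≡⟨ cong₂ _*_ (sym length-blocks*[1+t]≡NCt) 2[1+t]∸t≡2+t ⟩
      length blocks * suc t * suc (suc t) ≡⟨ xy∙z≈xz∙y (length blocks) (suc t) (suc (suc t)) ⟩
      length blocks * suc (suc t) * suc t ∎)

  cliqueOf : Subset (2 * suc t) → Subset (2 * suc t) → Set
  cliqueOf (inside  ∷ b) = Star (suc t) (outside ∷ b)
  cliqueOf (outside ∷ b) = Top  (suc t) (inside  ∷ b)

  cliqueOf-isClique : ∀ {B} → 𝓑 B → IsClique (2 * suc t) (suc t) (cliqueOf B)
  cliqueOf-isClique {inside  ∷ b} 𝓑B = Star-isClique (suc-injective (block-size 𝓑B))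
  cliqueOf-isClique {outside ∷ b} 𝓑B = Top-isClique (cong suc (block-size 𝓑B))

  cliqueOf-covers : ∀ {X} → ∣ X ∣ ≡ suc t → ∃ λ B → 𝓑 B × cliqueOf B X
  cliqueOf-covers {inside ∷ a} ∣X∣≡ with block-through {outside ∷ a} (suc-injective ∣X∣≡)
  ... | inside ∷ b , 𝓑B , a⊆b = inside ∷ b , 𝓑B , ∣X∣≡ , out⊆ (⊆-reflexive (sym a≡b))
    where
    a≡b : a ≡ b
    a≡b = p⊆q⇒∣q∣≤∣p∣⇒p≡q (drop-∷-⊆ a⊆b)
            (≤-reflexive (trans (suc-injective (block-size 𝓑B)) (sym (suc-injective ∣X∣≡))))
  ... | outside ∷ b , 𝓑B , a⊆b = outside ∷ b , 𝓑B , ∣X∣≡ , s⊆s (drop-∷-⊆ a⊆b)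
  cliqueOf-covers {outside ∷ a} ∣X∣≡ with block-within {inside ∷ a} (cong suc ∣X∣≡)
  ... | inside ∷ b , 𝓑B , b⊆a = inside ∷ b , 𝓑B , ∣X∣≡ , s⊆s (drop-∷-⊆ b⊆a)
  ... | outside ∷ b , 𝓑B , b⊆a = outside ∷ b , 𝓑B , ∣X∣≡ , out⊆ (⊆-reflexive (sym b≡a))
    where
    b≡a : b ≡ a
    b≡a = p⊆q⇒∣q∣≤∣p∣⇒p≡q (drop-∷-⊆ b⊆a) (≤-reflexive (trans ∣X∣≡ (sym (block-size 𝓑B))))

  blockCliqueCover : CliqueCover (2 * suc t) (suc t) (length blocks)
  blockCliqueCover = clique , (λ i → cliqueOf-isClique (∈-blocks⁻ (∈-lookup i))) , covered
    where
    clique : Fin (length blocks) → Subset (2 * suc t) → Set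
    clique i = cliqueOf (lookup blocks i)

    covered : ∀ X → IsVertex (2 * suc t) (suc t) X → ∃ λ i → clique i X
    covered X ∣X∣≡ = let B , 𝓑B , X∈ = cliqueOf-covers {X} ∣X∣≡; B∈ = ∈-blocks⁺ 𝓑B in
      index B∈ , subst (λ B → cliqueOf B X) (lookup-index B∈) X∈

corollary5p6 : (k : ℕ) → 1 ≤ k → SteinerSystemExists (2 * k) k (k ∸ 1) →
    CliqueCoverNumberIs (2 * k) k (catalan k)
corollary5p6 (suc t) _ (𝓑 , S) =
  subst (CliqueCoverNumberIs (2 * suc t) (suc t)) length-blocks≡catalan
        (blockCliqueCover , λ _ → length-blocks≤)
  where open SteinerSystem2k S
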